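{- Let $\{G_k\}_{k\ge1}$ be an increasing family of subgraphs of hypercubes with $\rho(\{G_k\})=c$, and let $G$ be a fixed (nonempty) subgraph of a hypercube. Then $\rho(\{G_k\,\square\,G\})=c$, where $\square$ denotes the Cartesian product of graphs.
   Context: For a subgraph $G$ of a hypercube with at least two vertices, $\rho(G)=\overline{{\rm deg}}(G)/\log_2|V(G)|$, where $\overline{{\rm deg}}(G)$ is the average degree of $G$. A family $\{G_k\}_{k\ge1}$ of subgraphs of hypercubes is increasing if $|V(G_{k+1})|>|V(G_k)|$ for all $k$; its hypercube density is $\rho(\{G_k\})=\limsup_{k\to\infty}\rho(G_k)$. Cartesian products of subgraphs of hypercubes are again subgraphs of hypercubes. -}

module Defs where

open import Data.Nat using (ℕ; zero; suc; _+_; _*_; _^_; _≤_; _<_)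
open import Data.Bool using (Bool; true; false; _∧_; _∨_; not; T)
open import Data.Vec using (Vec; []; _∷_; _++_; splitAt)
open import Data.List using (List; [_]; map; filterᵇ; length)
open import Data.Nat.ListAction using (sum)
open import Data.Product using (Σ; ∃; ∃-syntax; _×_; _,_; proj₁; proj₂)
open import Relation.Binary.PropositionalEquality using (_≡_)

allVecs : (n : ℕ) → List (Vec Bool n)
allVecs zero    = [ [] ]
allVecs (suc n) = map (true ∷_) (allVecs n) Data.List.++ map (false ∷_) (allVecs n)

-- Hamming distance; u, v adjacent in Q_n iff hamming u v ≡ 1
hamming : {n : ℕ} → Vec Bool n → Vec Bool n → ℕ
hamming []       []       = 0
hamming (x ∷ xs) (y ∷ ys) = (if x Data.Bool.xor y then 1 else 0) + hamming xs ys
  where open Data.Bool using (if_then_else_)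

eqVec : {n : ℕ} → Vec Bool n → Vec Bool n → Bool
eqVec []       []       = true
eqVec (x ∷ xs) (y ∷ ys) = not (x Data.Bool.xor y) ∧ eqVec xs ys

record QGraph : Set where
  field
    dim : ℕ
    V   : Vec Bool dim → Bool
    E   : Vec Bool dim → Vec Bool dim → Bool
open QGraph public

record IsSubQ (G : QGraph) : Set where
  field
    edge-adj : ∀ u v → T (E G u v) → hamming u v ≡ 1
    edge-V   : ∀ u v → T (E G u v) → T (V G u) × T (V G v)
    edge-sym : ∀ u v → T (E G u v) → T (E G v u)

nV : QGraph → ℕ
nV G = length (filterᵇ (V G) (allVecs (dim G)))

-- sum of degrees = number of ordered pairs (u,v) with uv ∈ E(G) = 2|E(G)|
degSum : QGraph → ℕ
degSum G = sum (map (λ u → length (filterᵇ (E G u) (allVecs (dim G)))) (allVecs (dim G)))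

-- Cartesian product G □ H, realised in Q_{dim G + dim H} on concatenated strings.
_□_ : QGraph → QGraph → QGraph
G □ H = record
  { dim = dim G + dim H
  ; V   = λ w → V G (proj₁ (splitAt (dim G) w)) ∧ V H (proj₁ (proj₂ (splitAt (dim G) w)))
  ; E   = λ w w' →
      let u  = proj₁ (splitAt (dim G) w)  ; v  = proj₁ (proj₂ (splitAt (dim G) w))
          u' = proj₁ (splitAt (dim G) w') ; v' = proj₁ (proj₂ (splitAt (dim G) w'))
      in (E G u u' ∧ eqVec v v' ∧ V H v) ∨ (eqVec u u' ∧ V G u ∧ E H v v')
  }

-- Hypercube density, encoded without real numbers.
--
-- ρ(G) = avgdeg(G) / log₂|V| with avgdeg = degSum/|V|.  For a rational
-- c/d (d > 0, c ≥ 0) and |V| ≥ 1: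
--   ρ(G) ≤ c/d  ⇔  d·degSum ≤ c·|V|·log₂|V|  ⇔  2^(d·degSum) ≤ |V|^(c·|V|).
RhoLe : QGraph → ℕ → ℕ → Set
RhoLe G c d = 2 ^ (d * degSum G) ≤ nV G ^ (c * nV G)

Eventually : (ℕ → Set) → Set
Eventually P = ∃[ N ] (∀ k → N ≤ k → P k)

-- "limsup_k ρ(Gs k) < a / (suc b)":  there is a rational c/(suc d) < a/(suc b)
-- with ρ(Gs k) ≤ c/(suc d) for all sufficiently large k.
LimsupLt : (ℕ → QGraph) → ℕ → ℕ → Set
LimsupLt Gs a b = ∃[ c ] ∃[ d ] ((c * suc b < a * suc d) × Eventually (λ k → RhoLe (Gs k) c (suc d)))

-- Equality of hypercube densities (limsups in [0,∞]) of two families: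
-- they have the same strict rational upper bounds.
SameDensity : (ℕ → QGraph) → (ℕ → QGraph) → Set
SameDensity Gs Hs = ∀ a b → (LimsupLt Gs a b → LimsupLt Hs a b) × (LimsupLt Hs a b → LimsupLt Gs a b)

Increasing : (ℕ → QGraph) → Set
Increasing Gs = ∀ k → nV (Gs k) < nV (Gs (suc k))

{-# OPTIONS --safe #-}
-- With n = |V(G_k)|, D = degSum(G_k), m = |V(G)| and e = degSum(G), the product has n·m vertices
-- and degree sum between D·m and D·m + n·e.  Writing ρ ≤ c/d as 2^(d·D) ≤ n^(c·n), the extra
-- n·e edges are absorbed as soon as 2^(d·t·e) ≤ n, and the extra factor m^(c·n) (after taking
-- an m-th root) as soon as m^(c·t) ≤ n; either way a bound c/d on one side gives the bound
-- (c·t + 1)/(d·t) = c/d + 1/(d·t) on the other.  Since the family is increasing, n ≥ k, so both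
-- conditions hold eventually, and t can be chosen to keep strict bounds on the limsup strict.
module Submission where

open import Defs
open import Data.Bool using (Bool; true; false; _∧_; _∨_; T; T?)
open import Data.List as List using (List; []; _∷_; map; filterᵇ; length)
open import Data.List.Membership.Propositional using (_∈_)
open import Data.List.Membership.Propositional.Properties
  using (∈-++⁺ˡ; ∈-++⁺ʳ; ∈-map⁺; ∈-filter⁺; ∈-length)
open import Data.List.Properties using (map-cong; map-++; map-∘)
open import Data.List.Relation.Unary.Any using (here)
open import Data.Nat
  using (ℕ; zero; suc; _+_; _*_; _^_; _≤_; _<_; _⊔_; z≤n; s≤s; NonZero; >-nonZero; _≤?_)
open import Data.Nat.ListAction using (sum)
open import Data.Nat.ListAction.Properties using (sum-++)
open import Data.Nat.Properties
open import Algebra.Properties.CommutativeSemigroup +-commutativeSemigroup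
  using () renaming (interchange to +-interchange)
open import Algebra.Properties.CommutativeSemigroup *-commutativeSemigroup
  using () renaming (interchange to *-interchange; xy∙z≈xz∙y to *-right-comm)
open import Data.Nat.Tactic.RingSolver using (solve-∀)
open import Data.Product using (∃-syntax; _,_)
open import Data.Vec using (Vec; []; _∷_; _++_; splitAt)
open import Function using (_∘_)
open import Relation.Binary.PropositionalEquality
open import Relation.Nullary using (yes; no; contradiction)

𝟙 : Bool → ℕ
𝟙 true  = 1
𝟙 false = 0

𝟙-∧ : ∀ a b → 𝟙 (a ∧ b) ≡ 𝟙 a * 𝟙 b
𝟙-∧ true  b = sym (+-identityʳ (𝟙 b))
𝟙-∧ false b = refl

𝟙-∧-∧ : ∀ a b c → 𝟙 (a ∧ b ∧ c) ≡ 𝟙 a * (𝟙 b * 𝟙 c)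
𝟙-∧-∧ a b c = trans (𝟙-∧ a (b ∧ c)) (cong (𝟙 a *_) (𝟙-∧ b c))

𝟙-∨-≤ : ∀ a b → 𝟙 (a ∨ b) ≤ 𝟙 a + 𝟙 b
𝟙-∨-≤ true  b = s≤s z≤n
𝟙-∨-≤ false b = ≤-refl

𝟙-≤-∨ : ∀ a b → 𝟙 a ≤ 𝟙 (a ∨ b)
𝟙-≤-∨ true  b = ≤-refl
𝟙-≤-∨ false b = z≤n

∑ : {A : Set} → List A → (A → ℕ) → ℕ
∑ xs f = sum (map f xs)

syntax ∑ xs (λ x → e) = ∑[ x ∈ xs ] e

module _ {A : Set} where

  ∑-cong : ∀ (xs : List A) {f g : A → ℕ} → (∀ x → f x ≡ g x) → ∑ xs f ≡ ∑ xs g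
  ∑-cong xs f≗g = cong sum (map-cong f≗g xs)

  ∑-mono-≤ : ∀ (xs : List A) {f g : A → ℕ} → (∀ x → f x ≤ g x) → ∑ xs f ≤ ∑ xs g
  ∑-mono-≤ []       f≤g = z≤n
  ∑-mono-≤ (x ∷ xs) f≤g = +-mono-≤ (f≤g x) (∑-mono-≤ xs f≤g)

  ∑-distrib-+ : ∀ (xs : List A) (f g : A → ℕ) → ∑[ x ∈ xs ] (f x + g x) ≡ ∑ xs f + ∑ xs g
  ∑-distrib-+ []       f g = refl
  ∑-distrib-+ (x ∷ xs) f g =
    trans (cong (f x + g x +_) (∑-distrib-+ xs f g)) (+-interchange (f x) (g x) _ _)

  *-distribˡ-∑ : ∀ c (xs : List A) (f : A → ℕ) → c * ∑ xs f ≡ ∑[ x ∈ xs ] (c * f x)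
  *-distribˡ-∑ c []       f = *-zeroʳ c
  *-distribˡ-∑ c (x ∷ xs) f = trans (*-distribˡ-+ c (f x) _) (cong (c * f x +_) (*-distribˡ-∑ c xs f))

  *-distribʳ-∑ : ∀ c (xs : List A) (f : A → ℕ) → ∑ xs f * c ≡ ∑[ x ∈ xs ] (f x * c)
  *-distribʳ-∑ c xs f =
    trans (*-comm _ c) (trans (*-distribˡ-∑ c xs f) (∑-cong xs (λ x → *-comm c (f x))))

  ∑-zero : ∀ (xs : List A) → ∑[ x ∈ xs ] 0 ≡ 0
  ∑-zero []       = refl
  ∑-zero (x ∷ xs) = ∑-zero xs

  ∑-++ : ∀ (xs ys : List A) (f : A → ℕ) → ∑ (xs List.++ ys) f ≡ ∑ xs f + ∑ ys f
  ∑-++ xs ys f = trans (cong sum (map-++ f xs ys)) (sum-++ (map f xs) (map f ys))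

  ∑-map : ∀ {B : Set} (g : A → B) (xs : List A) (f : B → ℕ) → ∑ (map g xs) f ≡ ∑ xs (f ∘ g)
  ∑-map g xs f = cong sum (sym (map-∘ xs))

  length-filterᵇ : ∀ (p : A → Bool) (xs : List A) → length (filterᵇ p xs) ≡ ∑[ x ∈ xs ] 𝟙 (p x)
  length-filterᵇ p []       = refl
  length-filterᵇ p (x ∷ xs) with p x
  ... | true  = cong suc (length-filterᵇ p xs)
  ... | false = length-filterᵇ p xs

module _ {A B : Set} (xs : List A) (ys : List B) where

  ∑∑-cong : ∀ {f g : A → B → ℕ} → (∀ x y → f x y ≡ g x y) →
            ∑[ x ∈ xs ] ∑[ y ∈ ys ] f x y ≡ ∑[ x ∈ xs ] ∑[ y ∈ ys ] g x y
  ∑∑-cong f≗g = ∑-cong xs (λ x → ∑-cong ys (f≗g x))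

  ∑∑-mono-≤ : ∀ {f g : A → B → ℕ} → (∀ x y → f x y ≤ g x y) →
              ∑[ x ∈ xs ] ∑[ y ∈ ys ] f x y ≤ ∑[ x ∈ xs ] ∑[ y ∈ ys ] g x y
  ∑∑-mono-≤ f≤g = ∑-mono-≤ xs (λ x → ∑-mono-≤ ys (f≤g x))

  ∑∑-distrib-+ : ∀ (f g : A → B → ℕ) →
                 ∑[ x ∈ xs ] ∑[ y ∈ ys ] (f x y + g x y) ≡
                 ∑[ x ∈ xs ] ∑[ y ∈ ys ] f x y + ∑[ x ∈ xs ] ∑[ y ∈ ys ] g x y
  ∑∑-distrib-+ f g = trans (∑-cong xs (λ x → ∑-distrib-+ ys (f x) (g x))) (∑-distrib-+ xs _ _)

  ∑-*-∑ : ∀ (f : A → ℕ) (g : B → ℕ) →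
          ∑ xs f * ∑ ys g ≡ ∑[ x ∈ xs ] ∑[ y ∈ ys ] (f x * g y)
  ∑-*-∑ f g = trans (*-distribʳ-∑ (∑ ys g) xs f) (∑-cong xs (λ x → *-distribˡ-∑ (f x) ys g))

∑-allVecs-suc : ∀ n (f : Vec Bool (suc n) → ℕ) →
                ∑ (allVecs (suc n)) f ≡
                ∑[ w ∈ allVecs n ] f (true ∷ w) + ∑[ w ∈ allVecs n ] f (false ∷ w)
∑-allVecs-suc n f = trans (∑-++ (map (true ∷_) (allVecs n)) _ f)
                          (cong₂ _+_ (∑-map (true ∷_) (allVecs n) f) (∑-map (false ∷_) (allVecs n) f))

∑-allVecs-++ : ∀ m n (f : Vec Bool (m + n) → ℕ) →
               ∑ (allVecs (m + n)) f ≡ ∑[ u ∈ allVecs m ] ∑[ v ∈ allVecs n ] f (u ++ v)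
∑-allVecs-++ zero    n f = sym (+-identityʳ _)
∑-allVecs-++ (suc m) n f = begin
  ∑ (allVecs (suc m + n)) f
    ≡⟨ ∑-allVecs-suc (m + n) f ⟩
  ∑ (allVecs (m + n)) (f ∘ (true ∷_)) + ∑ (allVecs (m + n)) (f ∘ (false ∷_))
    ≡⟨ cong₂ _+_ (∑-allVecs-++ m n (f ∘ (true ∷_))) (∑-allVecs-++ m n (f ∘ (false ∷_))) ⟩
  ∑[ u ∈ allVecs m ] ∑[ v ∈ allVecs n ] f (true ∷ u ++ v) +
  ∑[ u ∈ allVecs m ] ∑[ v ∈ allVecs n ] f (false ∷ u ++ v)
    ≡⟨ sym (∑-allVecs-suc m _) ⟩
  ∑[ u ∈ allVecs (suc m) ] ∑[ v ∈ allVecs n ] f (u ++ v) ∎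
  where open ≡-Reasoning

∑-allVecs-eqVec : ∀ n (v : Vec Bool n) → ∑[ w ∈ allVecs n ] 𝟙 (eqVec v w) ≡ 1
∑-allVecs-eqVec zero    []          = refl
∑-allVecs-eqVec (suc n) (true ∷ v)  =
  trans (∑-allVecs-suc n _) (cong₂ _+_ (∑-allVecs-eqVec n v) (∑-zero (allVecs n)))
∑-allVecs-eqVec (suc n) (false ∷ v) =
  trans (∑-allVecs-suc n _) (cong₂ _+_ (∑-zero (allVecs n)) (∑-allVecs-eqVec n v))

∈-allVecs : ∀ {n} (v : Vec Bool n) → v ∈ allVecs n
∈-allVecs []          = here refl
∈-allVecs (true ∷ v)  = ∈-++⁺ˡ (∈-map⁺ (true ∷_) (∈-allVecs v))
∈-allVecs (false ∷ v) = ∈-++⁺ʳ _ (∈-map⁺ (false ∷_) (∈-allVecs v))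

nV>0 : ∀ G → ∃[ v ] T (V G v) → 0 < nV G
nV>0 G (v , v∈G) = ∈-length (∈-filter⁺ (T? ∘ V G) (∈-allVecs v) v∈G)

splitAt-++ : ∀ {A : Set} {m n} (u : Vec A m) (v : Vec A n) → splitAt m (u ++ v) ≡ (u , v , refl)
splitAt-++ []      v = refl
splitAt-++ (x ∷ u) v rewrite splitAt-++ u v = refl

deg : (G : QGraph) → Vec Bool (dim G) → ℕ
deg G u = length (filterᵇ (E G u) (allVecs (dim G)))

nV-∑ : ∀ G → nV G ≡ ∑[ v ∈ allVecs (dim G) ] 𝟙 (V G v)
nV-∑ G = length-filterᵇ (V G) (allVecs (dim G))

deg-∑ : ∀ G u → deg G u ≡ ∑[ u′ ∈ allVecs (dim G) ] 𝟙 (E G u u′)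
deg-∑ G u = length-filterᵇ (E G u) (allVecs (dim G))

module _ (P H : QGraph) where

  private
    Qᴾ = allVecs (dim P)
    Qᴴ = allVecs (dim H)

  V-□ : ∀ u v → V (P □ H) (u ++ v) ≡ V P u ∧ V H v
  V-□ u v rewrite splitAt-++ u v = refl

  horizontal vertical : Vec Bool (dim P) → Vec Bool (dim H) → Vec Bool (dim P) → Vec Bool (dim H) → Bool
  horizontal u v u′ v′ = E P u u′ ∧ eqVec v v′ ∧ V H v
  vertical   u v u′ v′ = eqVec u u′ ∧ V P u ∧ E H v v′

  E-□ : ∀ u v u′ v′ →
        E (P □ H) (u ++ v) (u′ ++ v′) ≡ horizontal u v u′ v′ ∨ vertical u v u′ v′
  E-□ u v u′ v′ rewrite splitAt-++ u v | splitAt-++ u′ v′ = refl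

  nV-□ : nV (P □ H) ≡ nV P * nV H
  nV-□ = begin
    nV (P □ H)
      ≡⟨ nV-∑ (P □ H) ⟩
    ∑[ w ∈ allVecs (dim P + dim H) ] 𝟙 (V (P □ H) w)
      ≡⟨ ∑-allVecs-++ (dim P) (dim H) _ ⟩
    ∑[ u ∈ Qᴾ ] ∑[ v ∈ Qᴴ ] 𝟙 (V (P □ H) (u ++ v))
      ≡⟨ ∑∑-cong Qᴾ Qᴴ (λ u v → trans (cong 𝟙 (V-□ u v)) (𝟙-∧ (V P u) (V H v))) ⟩
    ∑[ u ∈ Qᴾ ] ∑[ v ∈ Qᴴ ] (𝟙 (V P u) * 𝟙 (V H v))
      ≡⟨ ∑-*-∑ Qᴾ Qᴴ _ _ ⟨
    ∑[ u ∈ Qᴾ ] 𝟙 (V P u) * ∑[ v ∈ Qᴴ ] 𝟙 (V H v)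
      ≡⟨ cong₂ _*_ (nV-∑ P) (nV-∑ H) ⟨
    nV P * nV H ∎
    where open ≡-Reasoning

  ∑-horizontal : ∀ u v →
                 ∑[ u′ ∈ Qᴾ ] ∑[ v′ ∈ Qᴴ ] 𝟙 (horizontal u v u′ v′) ≡ deg P u * 𝟙 (V H v)
  ∑-horizontal u v = begin
    ∑[ u′ ∈ Qᴾ ] ∑[ v′ ∈ Qᴴ ] 𝟙 (horizontal u v u′ v′)
      ≡⟨ ∑∑-cong Qᴾ Qᴴ (λ u′ v′ → 𝟙-∧-∧ (E P u u′) (eqVec v v′) (V H v)) ⟩
    ∑[ u′ ∈ Qᴾ ] ∑[ v′ ∈ Qᴴ ] (𝟙 (E P u u′) * (𝟙 (eqVec v v′) * 𝟙 (V H v)))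
      ≡⟨ ∑-*-∑ Qᴾ Qᴴ _ _ ⟨
    ∑[ u′ ∈ Qᴾ ] 𝟙 (E P u u′) * ∑[ v′ ∈ Qᴴ ] (𝟙 (eqVec v v′) * 𝟙 (V H v))
      ≡⟨ cong₂ _*_ (deg-∑ P u) (*-distribʳ-∑ (𝟙 (V H v)) Qᴴ (λ v′ → 𝟙 (eqVec v v′))) ⟨
    deg P u * (∑[ v′ ∈ Qᴴ ] 𝟙 (eqVec v v′) * 𝟙 (V H v))
      ≡⟨ cong (λ s → deg P u * (s * 𝟙 (V H v))) (∑-allVecs-eqVec (dim H) v) ⟩
    deg P u * (1 * 𝟙 (V H v))
      ≡⟨ cong (deg P u *_) (*-identityˡ _) ⟩
    deg P u * 𝟙 (V H v) ∎
    where open ≡-Reasoning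

  ∑-vertical : ∀ u v →
               ∑[ u′ ∈ Qᴾ ] ∑[ v′ ∈ Qᴴ ] 𝟙 (vertical u v u′ v′) ≡ 𝟙 (V P u) * deg H v
  ∑-vertical u v = begin
    ∑[ u′ ∈ Qᴾ ] ∑[ v′ ∈ Qᴴ ] 𝟙 (vertical u v u′ v′)
      ≡⟨ ∑∑-cong Qᴾ Qᴴ (λ u′ v′ → 𝟙-∧-∧ (eqVec u u′) (V P u) (E H v v′)) ⟩
    ∑[ u′ ∈ Qᴾ ] ∑[ v′ ∈ Qᴴ ] (𝟙 (eqVec u u′) * (𝟙 (V P u) * 𝟙 (E H v v′)))
      ≡⟨ ∑-*-∑ Qᴾ Qᴴ _ _ ⟨
    ∑[ u′ ∈ Qᴾ ] 𝟙 (eqVec u u′) * ∑[ v′ ∈ Qᴴ ] (𝟙 (V P u) * 𝟙 (E H v v′))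
      ≡⟨ cong₂ _*_ (∑-allVecs-eqVec (dim P) u)
                   (sym (*-distribˡ-∑ (𝟙 (V P u)) Qᴴ (λ v′ → 𝟙 (E H v v′)))) ⟩
    1 * (𝟙 (V P u) * ∑[ v′ ∈ Qᴴ ] 𝟙 (E H v v′))
      ≡⟨ *-identityˡ _ ⟩
    𝟙 (V P u) * ∑[ v′ ∈ Qᴴ ] 𝟙 (E H v v′)
      ≡⟨ cong (𝟙 (V P u) *_) (deg-∑ H v) ⟨
    𝟙 (V P u) * deg H v ∎
    where open ≡-Reasoning

  deg-□ : ∀ u v → deg (P □ H) (u ++ v) ≡
          ∑[ u′ ∈ Qᴾ ] ∑[ v′ ∈ Qᴴ ] 𝟙 (horizontal u v u′ v′ ∨ vertical u v u′ v′)
  deg-□ u v = begin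
    deg (P □ H) (u ++ v)
      ≡⟨ deg-∑ (P □ H) (u ++ v) ⟩
    ∑[ w′ ∈ allVecs (dim P + dim H) ] 𝟙 (E (P □ H) (u ++ v) w′)
      ≡⟨ ∑-allVecs-++ (dim P) (dim H) _ ⟩
    ∑[ u′ ∈ Qᴾ ] ∑[ v′ ∈ Qᴴ ] 𝟙 (E (P □ H) (u ++ v) (u′ ++ v′))
      ≡⟨ ∑∑-cong Qᴾ Qᴴ (λ u′ v′ → cong 𝟙 (E-□ u v u′ v′)) ⟩
    ∑[ u′ ∈ Qᴾ ] ∑[ v′ ∈ Qᴴ ] 𝟙 (horizontal u v u′ v′ ∨ vertical u v u′ v′) ∎
    where open ≡-Reasoning

  deg-□-≤ : ∀ u v → deg (P □ H) (u ++ v) ≤ deg P u * 𝟙 (V H v) + 𝟙 (V P u) * deg H v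
  deg-□-≤ u v = begin
    deg (P □ H) (u ++ v)
      ≡⟨ deg-□ u v ⟩
    ∑[ u′ ∈ Qᴾ ] ∑[ v′ ∈ Qᴴ ] 𝟙 (horizontal u v u′ v′ ∨ vertical u v u′ v′)
      ≤⟨ ∑∑-mono-≤ Qᴾ Qᴴ (λ u′ v′ → 𝟙-∨-≤ (horizontal u v u′ v′) _) ⟩
    ∑[ u′ ∈ Qᴾ ] ∑[ v′ ∈ Qᴴ ] (𝟙 (horizontal u v u′ v′) + 𝟙 (vertical u v u′ v′))
      ≡⟨ ∑∑-distrib-+ Qᴾ Qᴴ (λ u′ v′ → 𝟙 (horizontal u v u′ v′))
                            (λ u′ v′ → 𝟙 (vertical u v u′ v′)) ⟩
    ∑[ u′ ∈ Qᴾ ] ∑[ v′ ∈ Qᴴ ] 𝟙 (horizontal u v u′ v′) +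
    ∑[ u′ ∈ Qᴾ ] ∑[ v′ ∈ Qᴴ ] 𝟙 (vertical u v u′ v′)
      ≡⟨ cong₂ _+_ (∑-horizontal u v) (∑-vertical u v) ⟩
    deg P u * 𝟙 (V H v) + 𝟙 (V P u) * deg H v ∎
    where open ≤-Reasoning

  deg-□-≥ : ∀ u v → deg P u * 𝟙 (V H v) ≤ deg (P □ H) (u ++ v)
  deg-□-≥ u v = begin
    deg P u * 𝟙 (V H v)
      ≡⟨ ∑-horizontal u v ⟨
    ∑[ u′ ∈ Qᴾ ] ∑[ v′ ∈ Qᴴ ] 𝟙 (horizontal u v u′ v′)
      ≤⟨ ∑∑-mono-≤ Qᴾ Qᴴ (λ u′ v′ → 𝟙-≤-∨ (horizontal u v u′ v′) _) ⟩
    ∑[ u′ ∈ Qᴾ ] ∑[ v′ ∈ Qᴴ ] 𝟙 (horizontal u v u′ v′ ∨ vertical u v u′ v′)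
      ≡⟨ deg-□ u v ⟨
    deg (P □ H) (u ++ v) ∎
    where open ≤-Reasoning

  degSum-□-≤ : degSum (P □ H) ≤ degSum P * nV H + nV P * degSum H
  degSum-□-≤ = begin
    degSum (P □ H)
      ≡⟨ ∑-allVecs-++ (dim P) (dim H) (deg (P □ H)) ⟩
    ∑[ u ∈ Qᴾ ] ∑[ v ∈ Qᴴ ] deg (P □ H) (u ++ v)
      ≤⟨ ∑∑-mono-≤ Qᴾ Qᴴ deg-□-≤ ⟩
    ∑[ u ∈ Qᴾ ] ∑[ v ∈ Qᴴ ] (deg P u * 𝟙 (V H v) + 𝟙 (V P u) * deg H v)
      ≡⟨ ∑∑-distrib-+ Qᴾ Qᴴ (λ u v → deg P u * 𝟙 (V H v)) (λ u v → 𝟙 (V P u) * deg H v) ⟩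
    ∑[ u ∈ Qᴾ ] ∑[ v ∈ Qᴴ ] (deg P u * 𝟙 (V H v)) +
    ∑[ u ∈ Qᴾ ] ∑[ v ∈ Qᴴ ] (𝟙 (V P u) * deg H v)
      ≡⟨ cong₂ _+_ (∑-*-∑ Qᴾ Qᴴ (deg P) _) (∑-*-∑ Qᴾ Qᴴ _ (deg H)) ⟨
    degSum P * ∑[ v ∈ Qᴴ ] 𝟙 (V H v) + ∑[ u ∈ Qᴾ ] 𝟙 (V P u) * degSum H
      ≡⟨ cong₂ (λ x y → degSum P * x + y * degSum H) (nV-∑ H) (nV-∑ P) ⟨
    degSum P * nV H + nV P * degSum H ∎
    where open ≤-Reasoning

  degSum-□-≥ : degSum P * nV H ≤ degSum (P □ H)
  degSum-□-≥ = begin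
    degSum P * nV H
      ≡⟨ cong (degSum P *_) (nV-∑ H) ⟩
    degSum P * ∑[ v ∈ Qᴴ ] 𝟙 (V H v)
      ≡⟨ ∑-*-∑ Qᴾ Qᴴ (deg P) _ ⟩
    ∑[ u ∈ Qᴾ ] ∑[ v ∈ Qᴴ ] (deg P u * 𝟙 (V H v))
      ≤⟨ ∑∑-mono-≤ Qᴾ Qᴴ deg-□-≥ ⟩
    ∑[ u ∈ Qᴾ ] ∑[ v ∈ Qᴴ ] deg (P □ H) (u ++ v)
      ≡⟨ ∑-allVecs-++ (dim P) (dim H) (deg (P □ H)) ⟨
    degSum (P □ H) ∎
    where open ≤-Reasoning

^-distribʳ-* : ∀ m n o → (m * n) ^ o ≡ m ^ o * n ^ o
^-distribʳ-* m n zero    = refl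
^-distribʳ-* m n (suc o) =
  trans (cong (m * n *_) (^-distribʳ-* m n o)) (*-interchange m n (m ^ o) (n ^ o))

^-cancelʳ-≤ : ∀ o .{{_ : NonZero o}} {m n} → m ^ o ≤ n ^ o → m ≤ n
^-cancelʳ-≤ o {m} {n} mᵒ≤nᵒ with m ≤? n
... | yes m≤n = m≤n
... | no  m≰n = contradiction mᵒ≤nᵒ (<⇒≱ (^-monoˡ-< o (≰⇒> m≰n)))

m≤m^n : ∀ m n .{{_ : NonZero n}} → m ≤ m ^ n
m≤m^n zero    (suc n) = z≤n
m≤m^n (suc m) (suc n) = begin
  suc m            ≡⟨ *-identityʳ (suc m) ⟨
  suc m * 1        ≤⟨ *-monoʳ-≤ (suc m) (m^n>0 (suc m) n) ⟩
  suc m ^ suc n    ∎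
  where open ≤-Reasoning

ρ≤ : (n D c d : ℕ) → Set
ρ≤ n D c d = 2 ^ (d * D) ≤ n ^ (c * n)

ρ≤-antimono : ∀ {n D D′} c d → D ≤ D′ → ρ≤ n D′ c d → ρ≤ n D c d
ρ≤-antimono c d D≤D′ = ≤-trans (^-monoʳ-≤ 2 (*-monoʳ-≤ d D≤D′))

ρ≤-product : ∀ {n m D e} c d t → 0 < m → ρ≤ n D c d → 2 ^ (d * t * e) ≤ n →
             ρ≤ (n * m) (D * m + n * e) (c * t + 1) (d * t)
ρ≤-product {n} {m} {D} {e} c d t 0<m ρ≤c/d 2ᵈᵗᵉ≤n = begin
  2 ^ (d * t * (D * m + n * e))
    ≡⟨ cong (2 ^_) (split-exponent d t D m n e) ⟩
  2 ^ (d * D * (t * m) + d * t * e * n)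
    ≡⟨ ^-distribˡ-+-* 2 (d * D * (t * m)) _ ⟩
  2 ^ (d * D * (t * m)) * 2 ^ (d * t * e * n)
    ≡⟨ cong₂ _*_ (^-*-assoc 2 (d * D) (t * m)) (^-*-assoc 2 (d * t * e) n) ⟨
  (2 ^ (d * D)) ^ (t * m) * (2 ^ (d * t * e)) ^ n
    ≤⟨ *-mono-≤ (^-monoˡ-≤ (t * m) ρ≤c/d) (^-monoˡ-≤ n (≤-trans 2ᵈᵗᵉ≤n (m≤m^n n m))) ⟩
  (n ^ (c * n)) ^ (t * m) * (n ^ m) ^ n
    ≡⟨ cong₂ _*_ (^-*-assoc n (c * n) (t * m)) (^-*-assoc n m n) ⟩
  n ^ (c * n * (t * m)) * n ^ (m * n)
    ≡⟨ ^-distribˡ-+-* n (c * n * (t * m)) (m * n) ⟨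
  n ^ (c * n * (t * m) + m * n)
    ≡⟨ cong (n ^_) (merge-exponent c n t m) ⟩
  n ^ ((c * t + 1) * (n * m))
    ≤⟨ ^-monoˡ-≤ ((c * t + 1) * (n * m)) (m≤m*n n m) ⟩
  (n * m) ^ ((c * t + 1) * (n * m)) ∎
  where
  open ≤-Reasoning
  instance
    m≢0 : NonZero m
    m≢0 = >-nonZero 0<m
  split-exponent : ∀ d t D m n e → d * t * (D * m + n * e) ≡ d * D * (t * m) + d * t * e * n
  split-exponent = solve-∀
  merge-exponent : ∀ c n t m → c * n * (t * m) + m * n ≡ (c * t + 1) * (n * m)
  merge-exponent = solve-∀

ρ≤-factor : ∀ {n m D} c d t → 0 < m → ρ≤ (n * m) (D * m) c d → m ^ (c * t) ≤ n →
            ρ≤ n D (c * t + 1) (d * t)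
ρ≤-factor {n} {m} {D} c d t 0<m ρ≤c/d mᶜᵗ≤n = begin
  2 ^ (d * t * D)
    ≡⟨ cong (2 ^_) (*-right-comm d t D) ⟩
  2 ^ (d * D * t)
    ≡⟨ ^-*-assoc 2 (d * D) t ⟨
  (2 ^ (d * D)) ^ t
    ≤⟨ ^-monoˡ-≤ t mth-root ⟩
  ((n * m) ^ (c * n)) ^ t
    ≡⟨ ^-*-assoc (n * m) (c * n) t ⟩
  (n * m) ^ (c * n * t)
    ≡⟨ ^-distribʳ-* n m (c * n * t) ⟩
  n ^ (c * n * t) * m ^ (c * n * t)
    ≡⟨ cong (λ x → n ^ (c * n * t) * m ^ x) (*-right-comm c n t) ⟩
  n ^ (c * n * t) * m ^ (c * t * n)
    ≡⟨ cong (n ^ (c * n * t) *_) (^-*-assoc m (c * t) n) ⟨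
  n ^ (c * n * t) * (m ^ (c * t)) ^ n
    ≤⟨ *-monoʳ-≤ (n ^ (c * n * t)) (^-monoˡ-≤ n mᶜᵗ≤n) ⟩
  n ^ (c * n * t) * n ^ n
    ≡⟨ ^-distribˡ-+-* n (c * n * t) n ⟨
  n ^ (c * n * t + n)
    ≡⟨ cong (n ^_) (merge-exponent c n t) ⟩
  n ^ ((c * t + 1) * n) ∎
  where
  open ≤-Reasoning
  instance
    m≢0 : NonZero m
    m≢0 = >-nonZero 0<m
  merge-exponent : ∀ c n t → c * n * t + n ≡ (c * t + 1) * n
  merge-exponent = solve-∀
  mth-root : 2 ^ (d * D) ≤ (n * m) ^ (c * n)
  mth-root = ^-cancelʳ-≤ m (begin
    (2 ^ (d * D)) ^ m          ≡⟨ ^-*-assoc 2 (d * D) m ⟩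
    2 ^ (d * D * m)            ≡⟨ cong (2 ^_) (*-assoc d D m) ⟩
    2 ^ (d * (D * m))          ≤⟨ ρ≤c/d ⟩
    (n * m) ^ (c * (n * m))    ≡⟨ cong ((n * m) ^_) (*-assoc c n m) ⟨
    (n * m) ^ (c * n * m)      ≡⟨ ^-*-assoc (n * m) (c * n) m ⟨
    ((n * m) ^ (c * n)) ^ m    ∎)

Increasing⇒k≤nV : ∀ Gs → Increasing Gs → ∀ k → k ≤ nV (Gs k)
Increasing⇒k≤nV Gs inc zero    = z≤n
Increasing⇒k≤nV Gs inc (suc k) = ≤-trans (s≤s (Increasing⇒k≤nV Gs inc k)) (inc k)

module _ (Gs : ℕ → QGraph) (Gs-increasing : Increasing Gs) (G : QGraph) (|G|>0 : 0 < nV G) where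

  eventually-ρ≤-□ : ∀ c d t → Eventually (λ k → RhoLe (Gs k) c d) →
                    Eventually (λ k → RhoLe (Gs k □ G) (c * t + 1) (d * t))
  eventually-ρ≤-□ c d t (N , ρ≤c/d) = N ⊔ 2 ^ (d * t * degSum G) , λ k N⊔≤k →
    subst (λ x → ρ≤ x (degSum (Gs k □ G)) (c * t + 1) (d * t)) (sym (nV-□ (Gs k) G))
      (ρ≤-antimono (c * t + 1) (d * t) (degSum-□-≤ (Gs k) G)
        (ρ≤-product c d t |G|>0 (ρ≤c/d k (m⊔n≤o⇒m≤o N _ N⊔≤k))
          (≤-trans (m⊔n≤o⇒n≤o N _ N⊔≤k) (Increasing⇒k≤nV Gs Gs-increasing k))))

  eventually-ρ≤-□⁻ : ∀ c d t → Eventually (λ k → RhoLe (Gs k □ G) c d) →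
                     Eventually (λ k → RhoLe (Gs k) (c * t + 1) (d * t))
  eventually-ρ≤-□⁻ c d t (N , ρ≤c/d) = N ⊔ nV G ^ (c * t) , λ k N⊔≤k →
    ρ≤-factor c d t |G|>0
      (ρ≤-antimono c d (degSum-□-≥ (Gs k) G)
        (subst (λ x → ρ≤ x (degSum (Gs k □ G)) c d) (nV-□ (Gs k) G)
          (ρ≤c/d k (m⊔n≤o⇒m≤o N _ N⊔≤k))))
      (≤-trans (m⊔n≤o⇒n≤o N _ N⊔≤k) (Increasing⇒k≤nV Gs Gs-increasing k))

-- c/(d+1) < a/(b+1) leaves room to raise the bound by 1/((d+1)(b+2)).
<-slack : ∀ a b c d → c * suc b < a * suc d → (c * suc (suc b) + 1) * suc b < a * (suc d * suc (suc b))
<-slack a b c d c/d<a/b = begin-strict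
  (c * suc (suc b) + 1) * suc b   <⟨ n<1+n _ ⟩
  suc ((c * suc (suc b) + 1) * suc b) ≡⟨ rearrange b c ⟩
  suc (c * suc b) * suc (suc b)   ≤⟨ *-monoˡ-≤ (suc (suc b)) c/d<a/b ⟩
  a * suc d * suc (suc b)         ≡⟨ *-assoc a (suc d) (suc (suc b)) ⟩
  a * (suc d * suc (suc b))       ∎
  where
  open ≤-Reasoning
  rearrange : ∀ b c → suc ((c * suc (suc b) + 1) * suc b) ≡ suc (c * suc b) * suc (suc b)
  rearrange = solve-∀

LimsupLt-transfer : ∀ Gs Hs a b →
  (∀ c d → Eventually (λ k → RhoLe (Gs k) c (suc d)) →
             Eventually (λ k → RhoLe (Hs k) (c * suc (suc b) + 1) (suc d * suc (suc b)))) →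
  LimsupLt Gs a b → LimsupLt Hs a b
LimsupLt-transfer Gs Hs a b transfer (c , d , c/d<a/b , ρ≤c/d) =
  c * suc (suc b) + 1 , suc b + d * suc (suc b) , <-slack a b c d c/d<a/b , transfer c d ρ≤c/d

proposition5p6 : (Gs : ℕ → QGraph) → (∀ k → IsSubQ (Gs k)) → Increasing Gs →
                 (G : QGraph) → IsSubQ G → ∃[ v ] T (V G v) →
                 SameDensity (λ k → Gs k □ G) Gs
proposition5p6 Gs _ Gs-increasing G _ G≢∅ a b =
    LimsupLt-transfer Gs□G Gs a b (λ c d → eventually-ρ≤-□⁻ Gs Gs-increasing G |G|>0 c (suc d) t)
  , LimsupLt-transfer Gs Gs□G a b (λ c d → eventually-ρ≤-□ Gs Gs-increasing G |G|>0 c (suc d) t)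
  where
  Gs□G : ℕ → QGraph
  Gs□G k = Gs k □ G
  t = suc (suc b)
  |G|>0 : 0 < nV G
  |G|>0 = nV>0 G G≢∅
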